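{- Work constructively (IZF). Let $\Sigma$ be a purely relational signature and $\mathbb{T}$ a normal regular equality-free theory over $\Sigma$. For every $\Sigma$-structure $A$, the $\mathbb{T}$-chase $\mathrm{Ch}_{\mathbb{T}}(A)$ is a model of $\mathbb{T}$.
   Context: Signatures need not be discrete. $\Sigma$ purely relational means it has no function (or constant) symbols, so all terms are variables. A normal regular sequent is one of the form $\varphi(\vec x)\vdash_{\vec x}\exists\vec y\,\psi(\vec x,\vec y)$ with $\varphi,\psi$ finite conjunctions of atomic formulas and $\psi\vdash_{\vec x,\vec y}\varphi$ derivable in pure logic; a normal regular theory is a family of such; equality-free means no equality appears in its axioms. One-step extension: for a $\Sigma$-structure $A$, $\mathbb{T}^1(A)$ has domain the disjoint union of $|A|$ with the set of all triples $(\tau,\vec a,j)$, where $\tau=(\varphi\vdash_{\vec x}\exists\vec y\,\psi)$ is an axiom of $\mathbb{T}$, $\vec a$ is a tuple in $A$ with $A\models\varphi(\vec a)$, and $0\le j<\ell(\vec y)$; write $\iota_A : |A|\to|\mathbb{T}^1(A)|$ for the inclusion. For each relation symbol $R$, $R^{\mathbb{T}^1(A)}$ consists of $\iota_A(R^A)$ together with, for each such $\tau$, $\vec a$, and each conjunct $R(\vec t(\vec x,\vec y))$ of $\psi$, the tuple $\vec t(\iota(\vec a),\vec b)$, where $\vec b=((\tau,\vec a,j))_{0\le j<\ell(\vec y)}$ is the canonical witnessing tuple. This is functorial in $A$ and $\iota_A$ is a homomorphism. The $\mathbb{T}$-chase $\mathrm{Ch}_{\mathbb{T}}(A)$ is the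 colimit (union) of the chain $A\to\mathbb{T}^1(A)\to\mathbb{T}^1(\mathbb{T}^1(A))\to\cdots$ of these inclusions; a relation holds of a tuple in it iff it holds at some finite stage. -}

module Defs where

open import Data.Nat using (ℕ; zero; suc; _+_; _≤′_; ≤′-refl; ≤′-step)
open import Data.Fin using (Fin; _↑ˡ_)
open import Data.Vec using (Vec; map; _++_)
open import Data.Vec.Relation.Binary.Pointwise.Inductive using (Pointwise)
open import Data.List using (List)
open import Data.List.Relation.Unary.All using (All)
open import Data.List.Membership.Propositional using (_∈_)
open import Data.Product using (Σ; _×_; _,_; proj₁; proj₂)
open import Data.Sum using (_⊎_; inj₁; inj₂)
open import Data.Irrelevant using (Irrelevant)
open import Relation.Binary.PropositionalEquality using (_≡_)

-- A purely relational signature: a type (not necessarily discrete) of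
-- relation symbols, each with a finite arity. No function/constant symbols.
record Signature : Set₁ where
  field
    Rel   : Set
    arity : Rel → ℕ
open Signature public

module _ (Σg : Signature) where

  Atom : ℕ → Set
  Atom n = Σ (Rel Σg) (λ r → Vec (Fin n) (arity Σg r))

  Conj : ℕ → Set
  Conj n = List (Atom n)

  weakenAtom : {n : ℕ} (m : ℕ) → Atom n → Atom (n + m)
  weakenAtom m (r , v) = r , map (_↑ˡ m) v

  -- A normal regular equality-free sequent  φ(x⃗) ⊢_x⃗ ∃ y⃗ ψ(x⃗,y⃗),
  -- together with derivability of ψ ⊢_{x⃗,y⃗} φ (for equality-free
  -- conjunctions of atoms: every conjunct of φ is a conjunct of ψ).
  record Axiom : Set where
    field
      nx  : ℕ
      ny  : ℕ
      φ   : Conj nx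
      ψ   : Conj (nx + ny)
      ψ⊢φ : All (λ at → weakenAtom ny at ∈ ψ) φ
  open Axiom public

  record Theory : Set₁ where
    field
      Ix  : Set
      ax  : Ix → Axiom
  open Theory public

  record Structure : Set₁ where
    field
      Carrier : Set
      rel     : (r : Rel Σg) → Vec Carrier (arity Σg r) → Set
  open Structure public

  Sat : (M : Structure) {n : ℕ} → Conj n → Vec (Carrier M) n → Set
  Sat M φ′ a = All (λ at → rel M (proj₁ at) (map (Data.Vec.lookup a) (proj₂ at))) φ′

  Model : Theory → Structure → Set
  Model T M = (i : Ix T) (a : Vec (Carrier M) (nx (ax T i))) →
              Sat M (φ (ax T i)) a →
              Σ (Vec (Carrier M) (ny (ax T i)))
                (λ b → Sat M (ψ (ax T i)) (a ++ b))

  module OneStep (T : Theory) (A : Structure) where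

    record Triple : Set where
      constructor triple
      field
        τ   : Ix T
        a   : Vec (Carrier A) (nx (ax T τ))
        sat : Irrelevant (Sat A (φ (ax T τ)) a)
        j   : Fin (ny (ax T τ))

    Dom : Set
    Dom = Carrier A ⊎ Triple

    ι : Carrier A → Dom
    ι = inj₁

    witness : (τ : Ix T) (a : Vec (Carrier A) (nx (ax T τ))) →
              Irrelevant (Sat A (φ (ax T τ)) a) → Vec Dom (ny (ax T τ))
    witness τ a s = Data.Vec.tabulate (λ j → inj₂ (triple τ a s j))

    data Rel1 (r : Rel Σg) : Vec Dom (arity Σg r) → Set where
      old : (u : Vec (Carrier A) (arity Σg r)) → rel A r u → Rel1 r (map ι u)
      new : (τ : Ix T) (a : Vec (Carrier A) (nx (ax T τ)))
            (s : Irrelevant (Sat A (φ (ax T τ)) a))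
            (v : Vec (Fin (nx (ax T τ) + ny (ax T τ))) (arity Σg r)) →
            (r , v) ∈ ψ (ax T τ) →
            Rel1 r (map (Data.Vec.lookup (map ι a ++ witness τ a s)) v)

    T1 : Structure
    T1 = record { Carrier = Dom ; rel = Rel1 }

  T¹ : Theory → Structure → Structure
  T¹ T A = OneStep.T1 T A

  stage : Theory → Structure → ℕ → Structure
  stage T A zero    = A
  stage T A (suc k) = T¹ T (stage T A k)

  embed : (T : Theory) (A : Structure) {k m : ℕ} → k ≤′ m →
          Carrier (stage T A k) → Carrier (stage T A m)
  embed T A ≤′-refl       x = x
  embed T A (≤′-step p)   x = inj₁ (embed T A p x)

  -- The 𝕋-chase Ch_𝕋(A): the colimit (union) of the chain.
  -- Carrier: pairs (k, x) with x in stage k; two such elements are the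
  -- same element of the union iff they become equal at some later stage
  -- (relation ≈Ch below; relations of Ch are invariant under it).
  ChCarrier : Theory → Structure → Set
  ChCarrier T A = Σ ℕ (λ k → Carrier (stage T A k))

  _≈Ch_ : {T : Theory} {A : Structure} → ChCarrier T A → ChCarrier T A → Set
  _≈Ch_ {T} {A} (k , x) (l , y) =
    Σ ℕ (λ m → Σ (k ≤′ m) (λ p → Σ (l ≤′ m) (λ q → embed T A p x ≡ embed T A q y)))

  ChRel : (T : Theory) (A : Structure) (r : Rel Σg) →
          Vec (ChCarrier T A) (arity Σg r) → Set
  ChRel T A r t =
    Σ ℕ (λ k → Σ (Vec (Carrier (stage T A k)) (arity Σg r)) (λ u →
      rel (stage T A k) r u ×
      Pointwise (_≈Ch_ {T} {A}) t (map (λ x → (k , x)) u)))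

  Chase : Theory → Structure → Structure
  Chase T A = record { Carrier = ChCarrier T A ; rel = ChRel T A }

module Submission where

open import Defs
open import Data.Nat using (ℕ; suc; _≤_; _≤′_; ≤′-refl; ≤′-step; _⊔_)
open import Data.Nat.Properties
  using (≤-refl; ≤′-trans; ≤⇒≤′; ≤′⇒≤; n≮n; m⊔n≤o⇒m≤o; m⊔n≤o⇒n≤o)
open import Data.Fin using (Fin)
open import Data.Vec as Vec using (Vec; []; _∷_; _++_; lookup)
open import Data.Vec.Properties using (map-id; map-∘)
open import Data.Vec.Relation.Binary.Pointwise.Inductive as Pointwise
  using (Pointwise; []; _∷_)
open import Data.List using ([]; _∷_)
open import Data.List.Relation.Unary.All as All using ([]; _∷_)
open import Data.Product using (Σ; ∃; _×_; _,_)
open import Data.Sum using (inj₁)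
open import Data.Irrelevant using ([_])
open import Data.Empty using (⊥-elim)
open import Relation.Binary.PropositionalEquality
  using (_≡_; refl; sym; cong; cong₂; subst; module ≡-Reasoning)

-- A premise φ(a⃗) is a finite conjunction, and each of its atoms holds in the
-- chase because it holds at some finite stage; equivalent elements of the
-- chase coincide from some stage on. Hence at every late enough stage K the
-- representatives of a⃗ satisfy φ, the canonical witnesses added in stage
-- K + 1 satisfy ψ there, and so they satisfy ψ in the chase.

Eventually : (ℕ → Set) → Set
Eventually P = Σ ℕ λ N → ∀ {K} → N ≤ K → P K

eventually-≥′ : (k : ℕ) → Eventually (k ≤′_)
eventually-≥′ k = k , ≤⇒≤′

eventually-map : {P Q : ℕ → Set} → (∀ {K} → P K → Q K) → Eventually P → Eventually Q
eventually-map f (N , p) = N , λ N≤K → f (p N≤K)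

eventually-× : {P Q : ℕ → Set} → Eventually P → Eventually Q →
               Eventually (λ K → P K × Q K)
eventually-× (N , p) (M , q) =
  N ⊔ M , λ N⊔M≤K → p (m⊔n≤o⇒m≤o N M N⊔M≤K) , q (m⊔n≤o⇒n≤o N M N⊔M≤K)

eventually⇒∃ : {P : ℕ → Set} → Eventually P → ∃ P
eventually⇒∃ (N , p) = N , p ≤-refl

Pointwise-map-lookup : ∀ {A B : Set} {R : A → B → Set} {n m} {xs : Vec A n} {ys : Vec B n} →
                       Pointwise R xs ys → (v : Vec (Fin n) m) →
                       Pointwise R (Vec.map (lookup xs) v) (Vec.map (lookup ys) v)
Pointwise-map-lookup xs∼ys []      = []
Pointwise-map-lookup xs∼ys (i ∷ v) = Pointwise.lookup xs∼ys i ∷ Pointwise-map-lookup xs∼ys v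

module _ (Σg : Signature) (T : Theory Σg) (A : Structure Σg) where

  private
    Stage : ℕ → Set
    Stage k = Carrier (stage Σg T A k)

    Ch : Set
    Ch = ChCarrier Σg T A

    _≈_ : Ch → Ch → Set
    _≈_ = _≈Ch_ Σg {T} {A}

    embed′ : ∀ {k m} → k ≤′ m → Stage k → Stage m
    embed′ = embed Σg T A

  embed-irrelevant : ∀ {k m} (p q : k ≤′ m) (x : Stage k) → embed′ p x ≡ embed′ q x
  embed-irrelevant ≤′-refl     ≤′-refl     x = refl
  embed-irrelevant ≤′-refl     (≤′-step q) x = ⊥-elim (n≮n _ (≤′⇒≤ q))
  embed-irrelevant (≤′-step p) ≤′-refl     x = ⊥-elim (n≮n _ (≤′⇒≤ p))
  embed-irrelevant (≤′-step p) (≤′-step q) x = cong inj₁ (embed-irrelevant p q x)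

  embed-trans : ∀ {k m n} (p : k ≤′ m) (q : m ≤′ n) (x : Stage k) →
                embed′ (≤′-trans p q) x ≡ embed′ q (embed′ p x)
  embed-trans p ≤′-refl     x = refl
  embed-trans p (≤′-step q) x = cong inj₁ (embed-trans p q x)

  embed-factor : ∀ {k m n} (p : k ≤′ n) (q : k ≤′ m) (r : m ≤′ n) (x : Stage k) →
                 embed′ p x ≡ embed′ r (embed′ q x)
  embed-factor p q r x = begin
    embed′ p x                ≡⟨ embed-irrelevant p (≤′-trans q r) x ⟩
    embed′ (≤′-trans q r) x   ≡⟨ embed-trans q r x ⟩
    embed′ r (embed′ q x)     ∎
    where open ≡-Reasoning

  embed-preserves-rel : ∀ {k m} (p : k ≤′ m) (r : Rel Σg) (u : Vec (Stage k) (arity Σg r)) →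
                        rel (stage Σg T A k) r u →
                        rel (stage Σg T A m) r (Vec.map (embed′ p) u)
  embed-preserves-rel {k} ≤′-refl r u ru =
    subst (rel (stage Σg T A k) r) (sym (map-id u)) ru
  embed-preserves-rel {m = suc m} (≤′-step p) r u ru =
    subst (rel (stage Σg T A (suc m)) r) (sym (map-∘ inj₁ (embed′ p) u))
      (OneStep.old (Vec.map (embed′ p) u) (embed-preserves-rel p r u ru))

  Represents : (K : ℕ) → Ch → Stage K → Set
  Represents K (k , x) y = Σ (k ≤′ K) λ p → embed′ p x ≡ y

  represents-step : ∀ {K n} {c : Vec Ch n} {w : Vec (Stage K) n} →
                    Pointwise (Represents K) c w →
                    Pointwise (Represents (suc K)) c (Vec.map inj₁ w)
  represents-step []                 = []
  represents-step ((p , eq) ∷ reps) = (≤′-step p , cong inj₁ eq) ∷ represents-step reps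

  represents⇒≈ : ∀ {K e y} → Represents K e y → e ≈ (K , y)
  represents⇒≈ {K} (p , eq) = K , p , ≤′-refl , eq

  represents-self : ∀ {K n} (u : Vec (Stage K) n) →
                    Pointwise (Represents K) (Vec.map (K ,_) u) u
  represents-self []      = []
  represents-self (x ∷ u) = (≤′-refl , refl) ∷ represents-self u

  represents-embed : ∀ {k K n} (p : k ≤′ K) (u : Vec (Stage k) n) →
                     Pointwise (Represents K) (Vec.map (k ,_) u) (Vec.map (embed′ p) u)
  represents-embed p []      = []
  represents-embed p (x ∷ u) = (p , refl) ∷ represents-embed p u

  Pointwise-represents⇒≈ : ∀ {K n} {c : Vec Ch n} {c′ : Vec (Stage K) n} →
                           Pointwise (Represents K) c c′ → Pointwise _≈_ c (Vec.map (K ,_) c′)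
  Pointwise-represents⇒≈ []          = []
  Pointwise-represents⇒≈ (rep ∷ reps) = represents⇒≈ rep ∷ Pointwise-represents⇒≈ reps

  represents-eventually : (e : Ch) → Eventually λ K → ∃ (Represents K e)
  represents-eventually (k , x) =
    eventually-map (λ p → embed′ p x , p , refl) (eventually-≥′ k)

  representatives-eventually : ∀ {n} (c : Vec Ch n) →
                               Eventually λ K → Σ (Vec (Stage K) n) (Pointwise (Represents K) c)
  representatives-eventually []      = 0 , λ _ → [] , []
  representatives-eventually (e ∷ c) =
    eventually-map (λ { ((y , rep) , (w , reps)) → y ∷ w , rep ∷ reps })
      (eventually-× (represents-eventually e) (representatives-eventually c))

  represents-unique-eventually :
    ∀ {e e′} → e ≈ e′ →
    Eventually λ K → ∀ {y y′} → Represents K e y → Represents K e′ y′ → y ≡ y′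
  represents-unique-eventually {k , x} {l , x′} (m , p , q , eq) =
    m , λ m≤K {y} {y′} (p′ , eqy) (q′ , eqy′) →
      let r = ≤⇒≤′ m≤K
          open ≡-Reasoning
      in begin
        y                      ≡⟨ sym eqy ⟩
        embed′ p′ x            ≡⟨ embed-factor p′ p r x ⟩
        embed′ r (embed′ p x)  ≡⟨ cong (embed′ r) eq ⟩
        embed′ r (embed′ q x′) ≡⟨ sym (embed-factor q′ q r x′) ⟩
        embed′ q′ x′           ≡⟨ eqy′ ⟩
        y′                     ∎

  Pointwise-represents-unique-eventually :
    ∀ {n} {c c′ : Vec Ch n} → Pointwise _≈_ c c′ →
    Eventually λ K → ∀ {w w′ : Vec (Stage K) n} → Pointwise (Represents K) c w →
                     Pointwise (Represents K) c′ w′ → w ≡ w′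
  Pointwise-represents-unique-eventually [] = 0 , λ { _ [] [] → refl }
  Pointwise-represents-unique-eventually (e≈e′ ∷ c≈c′) =
    eventually-map (λ { (unique , uniques) (rep ∷ reps) (rep′ ∷ reps′) →
                          cong₂ _∷_ (unique rep rep′) (uniques reps reps′) })
      (eventually-× (represents-unique-eventually e≈e′)
                    (Pointwise-represents-unique-eventually c≈c′))

  sat-eventually : ∀ {n} (φs : Conj Σg n) {a : Vec Ch n} → Sat Σg (Chase Σg T A) φs a →
                   Eventually λ K → ∀ {a′} → Pointwise (Represents K) a a′ →
                                    Sat Σg (stage Σg T A K) φs a′
  sat-eventually []              []                                  = 0 , λ _ _ → []
  sat-eventually ((r , v) ∷ φs) ((k , u , ru , atom≈u) ∷ sat-φs) =
    eventually-map (λ { {K} ((p , unique) , sat-later) reps →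
                          subst (rel (stage Σg T A K) r)
                                (sym (unique (Pointwise-map-lookup reps v) (represents-embed p u)))
                                (embed-preserves-rel p r u ru)
                          ∷ sat-later reps })
      (eventually-× (eventually-× (eventually-≥′ k)
                                  (Pointwise-represents-unique-eventually atom≈u))
                    (sat-eventually φs sat-φs))

  chase-model : Model Σg T (Chase Σg T A)
  chase-model τ a sat-φ
    with eventually⇒∃ (eventually-× (representatives-eventually a)
                                     (sat-eventually (φ (ax T τ)) sat-φ))
  ... | K , (a′ , reps) , sat-later =
    Vec.map (suc K ,_) b ,
    All.tabulate λ { {r , v} r∈ψ →
      suc K , _ , OneStep.new τ a′ [ s ] v r∈ψ ,
      Pointwise-represents⇒≈
        (Pointwise-map-lookup
          (Pointwise.++⁺ (represents-step reps) (represents-self b)) v) }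
    where
    s : Sat Σg (stage Σg T A K) (φ (ax T τ)) a′
    s = sat-later reps

    b : Vec (Stage (suc K)) (ny (ax T τ))
    b = OneStep.witness Σg T (stage Σg T A K) τ a′ [ s ]

proposition4p6 : (Σg : Signature) (T : Theory Σg) (A : Structure Σg) →
                 Model Σg T (Chase Σg T A)
proposition4p6 = chase-model
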